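{- Let $G=(B,S,E)$ be a bipartite graph with buyers arriving in a fixed order, fix pairwise distinct prices $p_k\in[1/e,1]$ for the goods $k\in S$, and let $i\in B$, $j\in S$. Suppose that $1-p_j$ is larger than $1-p_k$ for every good $k$ that is adjacent to $i$ in $G_j$ and still unmatched when $i$ arrives in run $\mathcal{R}_j$ (this holds vacuously if there is no such good). Then in run $\mathcal{R}$, no good $k$ adjacent to $i$ and still unmatched when $i$ arrives satisfies $1-p_k>1-p_j$. (This is the No-Surpassing Property for OBM.)
   Context: Run $\mathcal{R}$: process the buyers of $G$ in arrival order, matching each arriving buyer to the cheapest (smallest price) still-unmatched good adjacent to her in $G$, leaving her unmatched if there is none; a good $k$ available to buyer $i$ is said to offer bid $1-p_k$. $G_j$ denotes $G$ with good $j$ removed, and run $\mathcal{R}_j$ is the same procedure, with the same prices and same arrival order, executed on $G_j$.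
   Formalization: The prices $p_k$ are rational numbers in [1/e,1]. -}

module Defs where

open import Data.Nat as ℕ using (ℕ; zero; suc; _!)
open import Data.Nat.Properties using (_!≢0)
open import Data.Integer using (+_)
open import Data.Rational using (ℚ; 0ℚ; 1ℚ; _+_; _*_; _/_; _≤_; _<?_)
open import Data.Fin using (Fin; _≟_)
open import Data.List using (List; []; _∷_; map; foldr)
open import Data.List.Base using (allFin)
open import Data.Bool using (Bool; true; false; _∧_; not; if_then_else_)
open import Data.Maybe using (Maybe; nothing; just)
open import Data.Product using (∃)
open import Relation.Nullary using (does)

-- A buyer is given by her adjacency row: the set of goods (Fin n) adjacent to her.
-- The bipartite graph G = (B, S, E) is a list of buyers in arrival order,
-- goods S = Fin n, and (lookup G i k ≡ true) iff (i , k) ∈ E.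
Buyer : ℕ → Set
Buyer n = Fin n → Bool

Matched : ℕ → Set
Matched n = Fin n → Bool

cheapest : ∀ {n} → (Fin n → ℚ) → (Fin n → Bool) → Maybe (Fin n)
cheapest {n} p c = foldr step nothing (allFin n)
  where
  step : Fin n → Maybe (Fin n) → Maybe (Fin n)
  step k acc with c k | acc
  ... | false | _       = acc
  ... | true  | nothing = just k
  ... | true  | just k' = if does (p k <? p k') then just k else just k'

mark : ∀ {n} → Fin n → Matched n → Matched n
mark k M l = if does (l ≟ k) then true else M l

arrive : ∀ {n} → (Fin n → ℚ) → Buyer n → Matched n → Matched n
arrive p a M with cheapest p (λ k → a k ∧ not (M k))
... | nothing = M
... | just k  = mark k M

runFrom : ∀ {n} → (Fin n → ℚ) → List (Buyer n) → Matched n → Matched n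
runFrom p []       M = M
runFrom p (a ∷ as) M = runFrom p as (arrive p a M)

run : ∀ {n} → (Fin n → ℚ) → List (Buyer n) → Matched n
run p bs = runFrom p bs (λ _ → false)

-- G_j : G with good j removed (j becomes adjacent to no buyer, hence is never
-- matched and never available; the other goods keep their indices).
removeGood : ∀ {n} → Fin n → List (Buyer n) → List (Buyer n)
removeGood j = map (λ a k → a k ∧ not (does (k ≟ j)))

eSum : ℕ → ℚ
eSum zero    = 1ℚ
eSum (suc N) = eSum N + (+ 1 / (suc N !)) {{suc N !≢0}}

-- for rational q: 1/e ≤ q  iff  1 ≤ q · (Σ_{k ≤ N} 1/k!) for some N
-- (equality q = 1/e is impossible for rational q since e is irrational)
AtLeastInvE : ℚ → Set
AtLeastInvE q = ∃ λ N → 1ℚ ≤ q * eSum N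

{-# OPTIONS --safe #-}

-- Run R and R_j side by side.  Throughout, every good free in R_j is free in R, and
-- every good free in R but not in R_j costs at least p_j (initially that surplus is {j}).
-- When R matches a buyer to a good that is also free in R_j, R_j picks the same good,
-- since prices are distinct; otherwise R consumes a surplus good c, and R_j's pick,
-- offered to the buyer in R as well, costs at least p_c ≥ p_j and joins the surplus.
-- So when buyer i arrives, each good offered to her in R is either offered in R_j, and
-- hence beaten by j, or costs at least p_j.

module Submission where

open import Defs
open import Data.Nat using (ℕ)
open import Data.Fin using (Fin; toℕ; _≟_)
open import Data.List using (List; []; _∷_; length; lookup; take; foldr; allFin)
open import Data.List.Properties using (take-map)
open import Data.List.Membership.Propositional using (_∈_)
open import Data.List.Membership.Propositional.Properties using (∈-allFin)
open import Data.List.Relation.Unary.Any using (here; there)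
open import Data.Bool using (Bool; true; false; _∧_; not; if_then_else_)
open import Data.Bool.Properties using (not-¬)
open import Data.Maybe using (Maybe; nothing; just)
open import Data.Rational using (ℚ; 1ℚ; _-_; _≤_; _<_; _<?_)
open import Data.Rational.Properties
  using (≤-refl; ≤-trans; ≤-antisym; <⇒≤; ≮⇒≥; <-asym; <-irrefl; <-≤-trans; neg-antimono-≤; +-monoʳ-≤)
open import Data.Product using (_×_; _,_; proj₁; proj₂; ∃)
open import Data.Sum using (_⊎_; inj₁; inj₂; [_,_]′)
open import Data.Empty using (⊥-elim)
open import Function using (id; _∘_)
open import Relation.Nullary using (¬_; Dec; does; yes; no)
open import Relation.Binary.PropositionalEquality using (_≡_; _≢_; refl; sym; subst)

module _ {n : ℕ} (p : Fin n → ℚ) (c : Fin n → Bool) where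

  data IsCheapestIn (xs : List (Fin n)) : Maybe (Fin n) → Set where
    nothing : (∀ {l} → l ∈ xs → c l ≡ false) → IsCheapestIn xs nothing
    just    : ∀ {k} → c k ≡ true → (∀ {l} → l ∈ xs → c l ≡ true → p k ≤ p l) →
              IsCheapestIn xs (just k)

  cheaper-∷ : ∀ {x k xs} → c x ≡ true → IsCheapestIn xs (just k) → (x<k? : Dec (p x < p k)) →
              IsCheapestIn (x ∷ xs) (if does x<k? then just x else just k)
  cheaper-∷ cx (just ck min) (yes x<k) =
    just cx λ { (here refl) _ → ≤-refl ; (there l∈) cl → ≤-trans (<⇒≤ x<k) (min l∈ cl) }
  cheaper-∷ cx (just ck min) (no x≮k) =
    just ck λ { (here refl) _ → ≮⇒≥ x≮k ; (there l∈) cl → min l∈ cl }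

  private
    -- the `where`-bound step of `cheapest`, otherwise inaccessible, given a name
    keepCheaper : Fin n → Maybe (Fin n) → Maybe (Fin n)
    keepCheaper = proj₁ {B = λ g → cheapest p c ≡ foldr g nothing (allFin n)} (_ , refl)

  foldr-keepCheaper : ∀ xs → IsCheapestIn xs (foldr keepCheaper nothing xs)
  foldr-keepCheaper [] = nothing λ ()
  foldr-keepCheaper (x ∷ xs) with c x in cx | foldr keepCheaper nothing xs | foldr-keepCheaper xs
  ... | false | _ | nothing none = nothing λ { (here refl) → cx ; (there l∈) → none l∈ }
  ... | false | _ | just ck min  = just ck λ { (here refl) cl → ⊥-elim (not-¬ cl cx)
                                            ; (there l∈) cl → min l∈ cl }
  ... | true | _ | nothing none = just cx λ { (here refl) _ → ≤-refl
                                            ; (there l∈) cl → ⊥-elim (not-¬ cl (none l∈)) }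
  ... | true | _ | just ck min = cheaper-∷ cx (just ck min) (p x <? p _)

  cheapest-isCheapest : IsCheapestIn (allFin n) (cheapest p c)
  cheapest-isCheapest = foldr-keepCheaper (allFin n)

module _ {n : ℕ} where

  Offered : Buyer n → Matched n → Fin n → Set
  Offered a M k = a k ≡ true × M k ≡ false

  ∧-not-offered : ∀ a M {k} → a k ∧ not (M k) ≡ true → Offered a M k
  ∧-not-offered a M {k} eq with a k | M k | eq
  ... | true  | false | _ = refl , refl
  ... | true  | true  | ()
  ... | false | _     | ()

  offered-∧-not : ∀ a M {k} → Offered a M k → a k ∧ not (M k) ≡ true
  offered-∧-not a M (ak , Mk) rewrite ak | Mk = refl

  module _ (p : Fin n → ℚ) (a : Buyer n) (M : Matched n) where

    data Arrival : Matched n → Set where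
      unmatched : (∀ {l} → ¬ Offered a M l) → Arrival M
      matched   : ∀ {k} → Offered a M k → (∀ {l} → Offered a M l → p k ≤ p l) → Arrival (mark k M)

    arrival : Arrival (arrive p a M)
    arrival with cheapest p (λ k → a k ∧ not (M k)) | cheapest-isCheapest p (λ k → a k ∧ not (M k))
    ... | nothing | nothing none = unmatched λ o → not-¬ (offered-∧-not a M o) (none (∈-allFin _))
    ... | just _  | just ck min  =
      matched (∧-not-offered a M ck) λ o → min (∈-allFin _) (offered-∧-not a M o)

module _ {n : ℕ} where

  mark-≡false⁻ : ∀ {k l} (M : Matched n) → mark k M l ≡ false → l ≢ k × M l ≡ false
  mark-≡false⁻ {k} {l} M eq with l ≟ k
  ... | no l≢k = l≢k , eq

  mark-≡false⁺ : ∀ {k l} (M : Matched n) → l ≢ k → M l ≡ false → mark k M l ≡ false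
  mark-≡false⁺ {k} {l} M l≢k eq with l ≟ k
  ... | yes l≡k = ⊥-elim (l≢k l≡k)
  ... | no _    = eq

  Available : Fin n → Matched n → Fin n → Set
  Available j M k = M k ≡ false × k ≢ j

  available-mark⁻ : ∀ {j c k} (M : Matched n) → Available j (mark c M) k → k ≢ c × Available j M k
  available-mark⁻ M (eq , k≢j) = let k≢c , Mk = mark-≡false⁻ M eq in k≢c , Mk , k≢j

  available-mark⁺ : ∀ {j c k} (M : Matched n) → k ≢ c → Available j M k → Available j (mark c M) k
  available-mark⁺ M k≢c (Mk , k≢j) = mark-≡false⁺ M k≢c Mk , k≢j

  dropGood : Fin n → Buyer n → Buyer n
  dropGood j a k = a k ∧ not (does (k ≟ j))

  offered-dropGood⁻ : ∀ {j k} (a : Buyer n) (M : Matched n) →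
                      Offered (dropGood j a) M k → a k ≡ true × Available j M k
  offered-dropGood⁻ {j} {k} a M (eq , Mk) with k ≟ j | a k | eq
  ... | no k≢j | true  | _  = refl , Mk , k≢j
  ... | no _   | false | ()
  ... | yes _  | true  | ()
  ... | yes _  | false | ()

  offered-dropGood⁺ : ∀ {j k} (a : Buyer n) (M : Matched n) →
                      a k ≡ true → Available j M k → Offered (dropGood j a) M k
  offered-dropGood⁺ {j} {k} a M ak (Mk , k≢j) with k ≟ j
  ... | yes k≡j = ⊥-elim (k≢j k≡j)
  ... | no _    rewrite ak = refl , Mk

module _ {n : ℕ} (p : Fin n → ℚ) (j : Fin n) where

  -- M is the matched set of R, M' that of R_j
  record Dominates (M M' : Matched n) : Set where
    field
      free-⊇    : ∀ {k} → Available j M' k → M k ≡ false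
      surplus-≥ : ∀ {k} → M k ≡ false → Available j M' k ⊎ p j ≤ p k

  open Dominates

  dominates-initial : Dominates (λ _ → false) (λ _ → false)
  dominates-initial .free-⊇ _ = refl
  dominates-initial .surplus-≥ {k} _ with k ≟ j
  ... | yes refl = inj₂ ≤-refl
  ... | no k≢j   = inj₁ (refl , k≢j)

  module _ {M M' : Matched n} (D : Dominates M M') where

    dominates-mark-both : ∀ c → Dominates (mark c M) (mark c M')
    dominates-mark-both c .free-⊇ av =
      let k≢c , av' = available-mark⁻ M' av in mark-≡false⁺ M k≢c (free-⊇ D av')
    dominates-mark-both c .surplus-≥ eq =
      let k≢c , Mk = mark-≡false⁻ M eq in
      [ (λ av → inj₁ (available-mark⁺ M' k≢c av)) , inj₂ ]′ (surplus-≥ D Mk)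

    dominates-mark-surplus : ∀ {c} → ¬ Available j M' c → Dominates (mark c M) M'
    dominates-mark-surplus c∉ .free-⊇ av = mark-≡false⁺ M (λ { refl → c∉ av }) (free-⊇ D av)
    dominates-mark-surplus c∉ .surplus-≥ eq = surplus-≥ D (proj₂ (mark-≡false⁻ M eq))

    dominates-mark-shadow : ∀ {c} → p j ≤ p c → Dominates M (mark c M')
    dominates-mark-shadow c≥ .free-⊇ av = free-⊇ D (proj₂ (available-mark⁻ M' av))
    dominates-mark-shadow {c} c≥ .surplus-≥ {k} Mk = [ shadow (k ≟ c) , inj₂ ]′ (surplus-≥ D Mk)
      where
      shadow : Dec (k ≡ c) → Available j M' k → Available j (mark c M') k ⊎ p j ≤ p k
      shadow (yes refl) _  = inj₂ c≥
      shadow (no k≢c)   av = inj₁ (available-mark⁺ M' k≢c av)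

    dominates-offered : ∀ a {k} → Offered (dropGood j a) M' k → Offered a M k
    dominates-offered a o' = let ak , av = offered-dropGood⁻ a M' o' in ak , free-⊇ D av

  module _ (p-inj : ∀ k l → p k ≡ p l → k ≡ l) where

    dominates-arrive : ∀ {a M M' R R'} → Dominates M M' →
                       Arrival p a M R → Arrival p (dropGood j a) M' R' → Dominates R R'
    dominates-arrive D (unmatched _)    (unmatched _)    = D
    dominates-arrive {a} D (unmatched none) (matched o' _) = ⊥-elim (none (dominates-offered D a o'))
    dominates-arrive {a} {M' = M'} D (matched o _) (unmatched none') =
      dominates-mark-surplus D λ av → none' (offered-dropGood⁺ a M' (proj₁ o) av)
    dominates-arrive {a} {M} {M'} D (matched {c} o cheapest) (matched {c'} o' cheapest') with c ≟ c'
    ... | yes refl = dominates-mark-both D c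
    ... | no c≢c'  = dominates-mark-shadow (dominates-mark-surplus D c∉)
                       (≤-trans c≥ (cheapest (dominates-offered D a o')))
      where
      c∉ : ¬ Available j M' c
      c∉ av = c≢c' (sym (p-inj c' c (≤-antisym (cheapest' (offered-dropGood⁺ a M' (proj₁ o) av))
                                                (cheapest (dominates-offered D a o')))))
      c≥ : p j ≤ p c
      c≥ = [ (λ av → ⊥-elim (c∉ av)) , id ]′ (surplus-≥ D (proj₂ o))

    dominates-runFrom : ∀ bs {M M'} → Dominates M M' →
                        Dominates (runFrom p bs M) (runFrom p (removeGood j bs) M')
    dominates-runFrom []       D = D
    dominates-runFrom (a ∷ as) {M} {M'} D =
      dominates-runFrom as (dominates-arrive D (arrival p a M) (arrival p (dropGood j a) M'))

    dominates-run : ∀ bs → Dominates (run p bs) (run p (removeGood j bs))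
    dominates-run bs = dominates-runFrom bs dominates-initial

bid-antimono : ∀ {q r} → q ≤ r → 1ℚ - r ≤ 1ℚ - q
bid-antimono q≤r = +-monoʳ-≤ 1ℚ (neg-antimono-≤ q≤r)

lemma3p6 : ∀ {n : ℕ} (G : List (Buyer n)) (p : Fin n → ℚ) →
    (∀ k l → p k ≡ p l → k ≡ l) →
    (∀ k → AtLeastInvE (p k) × p k ≤ 1ℚ) →
    (i : Fin (length G)) (j : Fin n) →
    (∀ k → lookup G i k ≡ true → k ≢ j →
      run p (take (toℕ i) (removeGood j G)) k ≡ false →
      1ℚ - p k < 1ℚ - p j) →
    ¬ (∃ λ k → lookup G i k ≡ true × run p (take (toℕ i) G) k ≡ false ×
      1ℚ - p j < 1ℚ - p k)
lemma3p6 G p p-inj _ i j j-beats (k , ik , k-free , k-surpasses) =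
  [ (λ (M'k , k≢j) → <-asym k-surpasses (j-beats k ik k≢j M'k))
  , (λ j≤k → <-irrefl refl (<-≤-trans k-surpasses (bid-antimono j≤k)))
  ]′ (Dominates.surplus-≥ D k-free)
  where
  D : Dominates p j (run p (take (toℕ i) G)) (run p (take (toℕ i) (removeGood j G)))
  D = subst (Dominates p j _ ∘ run p) (sym (take-map {f = dropGood j} (toℕ i) G))
            (dominates-run p j p-inj (take (toℕ i) G))
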